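{- Let $n=\prod_{i=1}^{r}p_i^{n_i}\prod_{i=r+1}^{s}p_i^{n_i}$ with distinct primes $p_1,\dots,p_s$ and $n_i\geqslant 1$, and let $k=u\prod_{i=1}^{r}p_i^{k_i}$ with $1\leqslant r\leqslant s$, $k_i\geqslant 1$ for all $i\leqslant r$, and $\gcd(u,p_i)=1$ for all $i\in\{1,\dots,s\}$. Let $G$ be the graph whose vertices are the positive divisors of $n$, with an edge between $m$ and $m'$ (and $m'$ declared the parent of $m$) if and only if $m<m'$ and $k\cdot A_m=A_{m'}$. Then $G$ is a disjoint union of rooted trees, where the roots are the vertices without parent, and moreover: (i) the connected components of $G$ are in bijection with the choices of exponents $(d_i)_{i=r+1,\dots,s}$ with $0\leqslant d_i\leqslant n_i$, the component corresponding to $(d_i)$ consisting of the divisors $m=\prod_{i=1}^s p_i^{m_i}$ of $n$ with $m_i=d_i$ for all $i\in\{r+1,\dots,s\}$; (ii) the leaves (vertices without children) are exactly the elements of $\mathcal{M}$; (iii) the root of the tree corresponding to $(d_i)_{i=r+1,\dots,s}$ is $\prod_{i=1}^{r}p_i^{n_i}\prod_{i=r+1}^{s}p_i^{d_i}$; (iv) a vertex $m=\prod_{i=1}^s p_i^{m_i}$ has level $j_m+1$, where $j_m=\min\{j\in\mathbb{N} : jk_i\geqslant n_i-m_i \text{ for all } i\in\{1,\dots,r\}\}$.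
   Context: Everything takes place in $\mathbb{Z}/n\mathbb{Z}$. For a divisor $m$ of $n$, $A_m=\{x\in\mathbb{Z}/n\mathbb{Z} : \gcd(x,n)=m\}$, and $k\cdot A=\{ka : a\in A\}$. $\mathcal{M}$ denotes the set of divisors $m=\prod_{i=1}^{s}p_i^{m_i}$ of $n$ ($m_i\leqslant n_i$) such that there exists $i_0\leqslant r$ with $m_{i_0}<\min(k_{i_0},n_{i_0})$. The level of a vertex in a rooted tree is $1$ plus the number of edges between it and the root. -}

module Defs where

open import Data.Nat using (ℕ; zero; suc; _+_; _*_; _∸_; _^_; _≤_; _<_; _<ᵇ_; _⊓_)
open import Data.Nat.Divisibility using (_∣_)
open import Data.Nat.GCD using (gcd)
open import Data.Fin using (Fin; toℕ) renaming (zero to fzero; suc to fsuc)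
open import Data.Bool using (if_then_else_)
open import Data.Product using (_×_; ∃; ∃-syntax; _,_)
open import Function using (_∘_)
open import Function.Bundles using (_⇔_)
open import Relation.Nullary using (¬_)
open import Relation.Binary.PropositionalEquality using (_≡_)
open import Relation.Binary.Construct.Closure.Equivalence using (EqClosure)

prodFin : ∀ {s} → (Fin s → ℕ) → ℕ
prodFin {zero}  f = 1
prodFin {suc s} f = f fzero * prodFin (f ∘ fsuc)

-- ∏ p_i ^ e_i  (indices are 0-based: paper's index i corresponds to Fin index i-1)
factor : ∀ {s} → (p e : Fin s → ℕ) → ℕ
factor p e = prodFin (λ i → p i ^ e i)

-- select r f g i = f i if (0-based) i < r, i.e. paper index ≤ r; g i otherwise
select : ∀ {s} → ℕ → (Fin s → ℕ) → (Fin s → ℕ) → Fin s → ℕ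
select r f g i = if toℕ i <ᵇ r then f i else g i

-- ℤ/nℤ represented by {0,…,n-1}

-- x ∈ A_m  (gcd(0,n) = n as usual)
A : (n m x : ℕ) → Set
A n m x = x < n × gcd x n ≡ m

-- y ∈ k·A_m : y is the residue mod n of k·a for some a ∈ A_m
InKA : (n k m y : ℕ) → Set
InKA n k m y = y < n × ∃[ a ] (A n m a × ∃[ q ] (k * a ≡ q * n + y))

Vertex : (n m : ℕ) → Set
Vertex n m = 0 < m × m ∣ n

Edge : (n k m m' : ℕ) → Set
Edge n k m m' = m < m' × (∀ y → InKA n k m y ⇔ A n m' y)

Parent : (n k m m' : ℕ) → Set
Parent n k m m' = Vertex n m × Vertex n m' × Edge n k m m'

IsRoot : (n k m : ℕ) → Set
IsRoot n k m = Vertex n m × ¬ (∃[ m' ] Parent n k m m')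

IsLeaf : (n k m : ℕ) → Set
IsLeaf n k m = Vertex n m × ¬ (∃[ c ] Parent n k c m)

Connected : (n k : ℕ) → ℕ → ℕ → Set
Connected n k = EqClosure (Parent n k)

PathToRoot : (n k m j : ℕ) → Set
PathToRoot n k m zero    = IsRoot n k m
PathToRoot n k m (suc j) = ∃[ m' ] (Parent n k m m' × PathToRoot n k m' j)

HasLevel : (n k m l : ℕ) → Set
HasLevel n k m l = ∃[ j ] (l ≡ suc j × PathToRoot n k m j)

InM : ∀ {s} → (p nexp kexp : Fin s → ℕ) (r m : ℕ) → Set
InM p nexp kexp r m =
  ∃[ e ] (m ≡ factor p e × (∀ i → e i ≤ nexp i) ×
          ∃[ i₀ ] (toℕ i₀ < r × e i₀ < kexp i₀ ⊓ nexp i₀))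

JGood : ∀ {s} → (nexp kexp e : Fin s → ℕ) (r j : ℕ) → Set
JGood nexp kexp e r j = ∀ i → toℕ i < r → nexp i ∸ e i ≤ j * kexp i

IsJm : ∀ {s} → (nexp kexp e : Fin s → ℕ) (r j : ℕ) → Set
IsJm nexp kexp e r j = JGood nexp kexp e r j × (∀ j' → JGood nexp kexp e r j' → j ≤ j')

{-# OPTIONS --safe #-}
-- For m ∣ n and x ∈ A_m one has gcd(kx, n) = gcd(km, n); conversely every y ∈ A_g, g = gcd(km, n),
-- is kx for some x ∈ A_m: write y = g y', n = g N, km = g c with c, y' prime to N, solve
-- c x' ≡ y' (mod N), lift x' to a unit a' modulo n and take x = m a'. Hence k·A_m = A_gcd(km,n), so m
-- has a parent iff gcd(km, n) > m, and then the parent is gcd(km, n).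
-- In exponents the parent of m = ∏ p_i^e_i is ∏ p_i^min(e_i + k_i, n_i) (with k_i = 0 for i > r): the
-- tail (e_i)_{i>r} is invariant, the head exponents grow by k_i until they saturate at n_i, and the
-- roots are the vertices with saturated head. Subtracting k_i from the head exponents gives a child
-- exactly when e_i ≥ min(k_i, n_i) for all i ≤ r, and j_m is the number of steps to saturate the head.
module Submission where

open import Defs
open import Data.Nat using (ℕ; zero; suc; _+_; _*_; _^_; _≤_; _<_; _∸_; _⊓_; z≤n; s≤s; z<s; NonZero; >-nonZero; >-nonZero⁻¹; ≢-nonZero; ≢-nonZero⁻¹; _<ᵇ_)
open import Data.Nat.Base using (nonTrivial⇒n>1; s≤s⁻¹)
open import Data.Nat.Properties
open import Data.Nat.Divisibility
open import Data.Nat.DivMod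
open import Data.Nat.GCD
open import Data.Nat.Coprimality as Coprime using (Coprime; coprime-divisor; coprime⇒gcd≡1; coprime-Bézout)
open import Data.Nat.Primality using (Prime; euclidsLemma; prime⇒irreducible; prime⇒nonTrivial; prime⇒nonZero)
open import Data.Nat.Tactic.RingSolver using (solve-∀)
open import Data.Fin using (Fin; toℕ; fromℕ<) renaming (zero to fzero; suc to fsuc)
open import Data.Fin.Properties using (all?; any?; toℕ-fromℕ<) renaming (suc-injective to fsuc-injective)
open import Data.Vec.Functional using (_∷_)
open import Data.Bool using (true; false; T; if_then_else_)
open import Data.Unit using (tt)
open import Data.Product using (_×_; ∃-syntax; _,_; proj₁; proj₂)
open import Data.Sum using (inj₁; inj₂)
open import Data.Empty using (⊥-elim)
open import Function using (_∘_; const)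
open import Function.Bundles using (_⇔_; mk⇔; Equivalence)
open import Function.Definitions using (Injective)
open import Relation.Nullary using (¬_; Dec; yes; no; does)
open import Relation.Nullary.Decidable using (dec-false; _→-dec_; _×-dec_)
open import Relation.Binary.PropositionalEquality
open import Relation.Binary.Construct.Closure.Equivalence using (symmetric)
open import Relation.Binary.Construct.Closure.Symmetric using (fwd; bwd)
open import Relation.Binary.Construct.Closure.ReflexiveTransitive using (ε; _◅_; _◅◅_)

prime⇒1< : ∀ {p} → Prime p → 1 < p
prime⇒1< {p} pr = nonTrivial⇒n>1 p {{prime⇒nonTrivial pr}}

prime∤1 : ∀ {p} → Prime p → ¬ p ∣ 1
prime∤1 pr p∣1 = <-irrefl (sym (∣1⇒≡1 p∣1)) (prime⇒1< pr)

prime∤⇒coprime : ∀ {p x} → Prime p → ¬ p ∣ x → Coprime p x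
prime∤⇒coprime pr p∤x (d∣p , d∣x) with prime⇒irreducible pr d∣p
... | inj₁ d≡1  = d≡1
... | inj₂ refl = ⊥-elim (p∤x d∣x)

prime∣prime⇒≡ : ∀ {p q} → Prime p → Prime q → p ∣ q → p ≡ q
prime∣prime⇒≡ pp pq p∣q with prime⇒irreducible pq p∣q
... | inj₁ refl = ⊥-elim (<-irrefl refl (prime⇒1< pp))
... | inj₂ p≡q  = p≡q

coprime-1 : ∀ {a} → Coprime a 1
coprime-1 (_ , d∣1) = ∣1⇒≡1 d∣1

coprime-* : ∀ {a b c} → Coprime a b → Coprime a c → Coprime a (b * c)
coprime-* {a} {b} a⊥b a⊥c {d} (d∣a , d∣bc) = a⊥c (d∣a , coprime-divisor d⊥b d∣bc)
  where
  d⊥b : Coprime d b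
  d⊥b (e∣d , e∣b) = a⊥b (∣-trans e∣d d∣a , e∣b)

coprime-^ : ∀ {a b} → Coprime a b → ∀ k → Coprime a (b ^ k)
coprime-^ a⊥b zero    = coprime-1
coprime-^ a⊥b (suc k) = coprime-* a⊥b (coprime-^ a⊥b k)

coprime-∣ʳ : ∀ {a b c} → Coprime a b → c ∣ b → Coprime a c
coprime-∣ʳ a⊥b c∣b (d∣a , d∣c) = a⊥b (d∣a , ∣-trans d∣c c∣b)

p^a∣p^b⇒a≤b : ∀ {p a b} → 1 < p → p ^ a ∣ p ^ b → a ≤ b
p^a∣p^b⇒a≤b {p} {a} {b} 1<p p^a∣p^b = ≮⇒≥ λ b<a →
  <⇒≱ (^-monoʳ-< p 1<p b<a) (∣⇒≤ {{m^n≢0 p b {{>-nonZero (<-trans z<s 1<p)}}}} p^a∣p^b)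

a≤b⇒p^a∣p^b : ∀ {p a b} → a ≤ b → p ^ a ∣ p ^ b
a≤b⇒p^a∣p^b {p} {a} {b} a≤b = divides (p ^ (b ∸ a)) (begin
  p ^ b              ≡⟨ cong (p ^_) (m+[n∸m]≡n a≤b) ⟨
  p ^ (a + (b ∸ a))  ≡⟨ ^-distribˡ-+-* p a (b ∸ a) ⟩
  p ^ a * p ^ (b ∸ a) ≡⟨ *-comm (p ^ a) _ ⟩
  p ^ (b ∸ a) * p ^ a ∎)
  where open ≡-Reasoning

∣p^a*m⇒≡p^b*d : ∀ {p} → Prime p → ∀ a {m d} → d ∣ p ^ a * m →
          ∃[ b ] ∃[ d' ] (b ≤ a × d' ∣ m × d ≡ p ^ b * d')
∣p^a*m⇒≡p^b*d pr zero {m} {d} d∣m = 0 , d , z≤n , subst (d ∣_) (*-identityˡ m) d∣m , sym (*-identityˡ d)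
∣p^a*m⇒≡p^b*d {p} pr (suc a) {m} {d} d∣ with p ∣? d
... | no p∤d = let b , d' , b≤a , d'∣m , d≡ = ∣p^a*m⇒≡p^b*d pr a d∣p^a*m
               in b , d' , m≤n⇒m≤1+n b≤a , d'∣m , d≡
  where
  d∣p^a*m : d ∣ p ^ a * m
  d∣p^a*m = coprime-divisor (Coprime.sym (prime∤⇒coprime pr p∤d)) (subst (d ∣_) (*-assoc p (p ^ a) m) d∣)
... | yes (divides q refl) =
  let b , d' , b≤a , d'∣m , q≡ = ∣p^a*m⇒≡p^b*d pr a q∣p^a*m
  in suc b , d' , s≤s b≤a , d'∣m , trans (cong (_* p) q≡) (sym (rotate p (p ^ b) d'))
  where
  instance _ = prime⇒nonZero pr
  rotate : ∀ p x y → p * x * y ≡ x * y * p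
  rotate = solve-∀
  q∣p^a*m : q ∣ p ^ a * m
  q∣p^a*m = *-cancelʳ-∣ p (subst (q * p ∣_) (rotate p (p ^ a) m) d∣)

prodFin-cong : ∀ {s} {f g : Fin s → ℕ} → (∀ i → f i ≡ g i) → prodFin f ≡ prodFin g
prodFin-cong {zero}  f≗g = refl
prodFin-cong {suc s} f≗g = cong₂ _*_ (f≗g fzero) (prodFin-cong (f≗g ∘ fsuc))

prodFin-* : ∀ {s} (f g : Fin s → ℕ) → prodFin (λ i → f i * g i) ≡ prodFin f * prodFin g
prodFin-* {zero}  f g = refl
prodFin-* {suc s} f g = trans (cong (f fzero * g fzero *_) (prodFin-* (f ∘ fsuc) (g ∘ fsuc)))
                              (interchange (f fzero) (g fzero) (prodFin (f ∘ fsuc)) (prodFin (g ∘ fsuc)))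
  where
  interchange : ∀ a b c d → a * b * (c * d) ≡ a * c * (b * d)
  interchange = solve-∀

prodFin-mono-∣ : ∀ {s} {f g : Fin s → ℕ} → (∀ i → f i ∣ g i) → prodFin f ∣ prodFin g
prodFin-mono-∣ {zero}  f∣g = ∣-refl
prodFin-mono-∣ {suc s} f∣g = *-pres-∣ (f∣g fzero) (prodFin-mono-∣ (f∣g ∘ fsuc))

∣prodFin : ∀ {s} (f : Fin s → ℕ) j → f j ∣ prodFin f
∣prodFin f fzero    = m∣m*n _
∣prodFin f (fsuc j) = ∣-trans (∣prodFin (f ∘ fsuc) j) (n∣m*n (f fzero))

prodFin≢0 : ∀ {s} {f : Fin s → ℕ} → (∀ i → NonZero (f i)) → NonZero (prodFin f)
prodFin≢0 {zero}  f≢0 = _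
prodFin≢0 {suc s} {f} f≢0 = m*n≢0 (f fzero) _ {{f≢0 fzero}} {{prodFin≢0 (f≢0 ∘ fsuc)}}

coprime-prodFin : ∀ {s a} {f : Fin s → ℕ} → (∀ i → Coprime a (f i)) → Coprime a (prodFin f)
coprime-prodFin {zero}  a⊥f = coprime-1
coprime-prodFin {suc s} a⊥f = coprime-* (a⊥f fzero) (coprime-prodFin (a⊥f ∘ fsuc))

prime∣prodFin⇒∣ : ∀ {s q} {f : Fin s → ℕ} → Prime q → q ∣ prodFin f → ∃[ j ] q ∣ f j
prime∣prodFin⇒∣ {zero}  pr q∣1 = ⊥-elim (prime∤1 pr q∣1)
prime∣prodFin⇒∣ {suc s} {f = f} pr q∣ with euclidsLemma (f fzero) _ pr q∣
... | inj₁ q∣f₀ = fzero , q∣f₀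
... | inj₂ q∣∏  = let j , q∣fj = prime∣prodFin⇒∣ pr q∣∏ in fsuc j , q∣fj

factor-+ : ∀ {s} (p a b : Fin s → ℕ) → factor p (λ i → a i + b i) ≡ factor p a * factor p b
factor-+ p a b = trans (prodFin-cong (λ i → ^-distribˡ-+-* (p i) (a i) (b i)))
                       (prodFin-* (λ i → p i ^ a i) (λ i → p i ^ b i))

factor-cong : ∀ {s} (p : Fin s → ℕ) {e f} → (∀ i → e i ≡ f i) → factor p e ≡ factor p f
factor-cong p e≗f = prodFin-cong (λ i → cong (p i ^_) (e≗f i))

factor-mono-∣ : ∀ {s} (p : Fin s → ℕ) {e f} → (∀ i → e i ≤ f i) → factor p e ∣ factor p f
factor-mono-∣ p e≤f = prodFin-mono-∣ (λ i → a≤b⇒p^a∣p^b (e≤f i))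

factor≢0 : ∀ {s} {p : Fin s → ℕ} → (∀ i → Prime (p i)) → ∀ e → NonZero (factor p e)
factor≢0 {p = p} primes e = prodFin≢0 (λ i → m^n≢0 (p i) (e i) {{prime⇒nonZero (primes i)}})

coprime-factor : ∀ {s a} {p : Fin s → ℕ} → (∀ i → Prime (p i)) → (∀ i → ¬ p i ∣ a) →
                 ∀ e → Coprime a (factor p e)
coprime-factor primes p∤a e = coprime-prodFin λ i →
  coprime-^ (Coprime.sym (prime∤⇒coprime (primes i) (p∤a i))) (e i)

∣factor⇒factor : ∀ {s} {p : Fin s → ℕ} → (∀ i → Prime (p i)) →
                 ∀ f {d} → d ∣ factor p f → ∃[ e ] ((∀ i → e i ≤ f i) × d ≡ factor p e)
∣factor⇒factor {zero}  primes f d∣1 = (λ ()) , (λ ()) , ∣1⇒≡1 d∣1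
∣factor⇒factor {suc s} {p} primes f d∣ =
  let b , d' , b≤f₀ , d'∣ , d≡ = ∣p^a*m⇒≡p^b*d (primes fzero) (f fzero) d∣
      e' , e'≤ , d'≡ = ∣factor⇒factor (primes ∘ fsuc) (f ∘ fsuc) d'∣
  in (b ∷ e') , (λ { fzero → b≤f₀ ; (fsuc i) → e'≤ i }) , trans d≡ (cong (p fzero ^ b *_) d'≡)

distinct-primes-∤ : ∀ {s} {p : Fin s → ℕ} → (∀ i → Prime (p i)) → Injective _≡_ _≡_ p →
                    ∀ {i j} → i ≢ j → ¬ p i ∣ p j
distinct-primes-∤ primes p-inj i≢j p∣p = i≢j (p-inj (prime∣prime⇒≡ (primes _) (primes _) p∣p))

factor-∣⇒≤ : ∀ {s} {p : Fin s → ℕ} → (∀ i → Prime (p i)) → Injective _≡_ _≡_ p →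
             ∀ e f → factor p e ∣ factor p f → ∀ i → e i ≤ f i
factor-∣⇒≤ {suc s} {p} primes p-inj e f e∣f fzero =
  p^a∣p^b⇒a≤b (prime⇒1< (primes fzero)) (coprime-divisor (p₀^-⊥-rest (e fzero) (f ∘ fsuc))
    (subst (p fzero ^ e fzero ∣_) (*-comm (p fzero ^ f fzero) _) (∣-trans (m∣m*n _) e∣f)))
  where
  p₀^-⊥-rest : ∀ a g → Coprime (p fzero ^ a) (factor (p ∘ fsuc) g)
  p₀^-⊥-rest a g = Coprime.sym (coprime-^ (Coprime.sym
    (coprime-factor (primes ∘ fsuc) (λ j → distinct-primes-∤ primes p-inj λ ()) g)) a)
factor-∣⇒≤ {suc s} {p} primes p-inj e f e∣f (fsuc i) =
  factor-∣⇒≤ (primes ∘ fsuc) (fsuc-injective ∘ p-inj) (e ∘ fsuc) (f ∘ fsuc)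
    (coprime-divisor rest-⊥-p₀^ (∣-trans (n∣m*n (p fzero ^ e fzero)) e∣f)) i
  where
  rest-⊥-p₀^ : Coprime (factor (p ∘ fsuc) (e ∘ fsuc)) (p fzero ^ f fzero)
  rest-⊥-p₀^ = coprime-^ (Coprime.sym
    (coprime-factor (primes ∘ fsuc) (λ j → distinct-primes-∤ primes p-inj λ ()) (e ∘ fsuc))) (f fzero)

module _ {s} {p : Fin s → ℕ} (primes : ∀ i → Prime (p i)) (p-inj : Injective _≡_ _≡_ p) where

  factor-injective : ∀ e f → factor p e ≡ factor p f → ∀ i → e i ≡ f i
  factor-injective e f e≡f i = ≤-antisym (factor-∣⇒≤ primes p-inj e f (∣-reflexive e≡f) i)
                                         (factor-∣⇒≤ primes p-inj f e (∣-reflexive (sym e≡f)) i)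

  gcd-factor : ∀ a b → gcd (factor p a) (factor p b) ≡ factor p (λ i → a i ⊓ b i)
  gcd-factor a b =
    let c , c≤b , g≡ = ∣factor⇒factor primes b (gcd[m,n]∣n (factor p a) (factor p b))
        c≤a = factor-∣⇒≤ primes p-inj c a (subst (_∣ factor p a) g≡ (gcd[m,n]∣m (factor p a) (factor p b)))
    in ∣-antisym
      (subst (_∣ _) (sym g≡) (factor-mono-∣ p (λ i → ⊓-glb (c≤a i) (c≤b i))))
      (gcd-greatest (factor-mono-∣ p (λ i → m⊓n≤m (a i) (b i))) (factor-mono-∣ p (λ i → m⊓n≤n (a i) (b i))))

gcd[m+kn,n]≡gcd[m,n] : ∀ m k n → gcd (m + k * n) n ≡ gcd m n
gcd[m+kn,n]≡gcd[m,n] m k n = ∣-antisym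
  (gcd-greatest (∣m+n∣n⇒∣m (gcd[m,n]∣m (m + k * n) n) (∣n⇒∣m*n k (gcd[m,n]∣n (m + k * n) n)))
                (gcd[m,n]∣n (m + k * n) n))
  (gcd-greatest (∣m∣n⇒∣m+n (gcd[m,n]∣m m n) (∣n⇒∣m*n k (gcd[m,n]∣n m n))) (gcd[m,n]∣n m n))
  where
  ∣m+n∣n⇒∣m : ∀ {d a b} → d ∣ a + b → d ∣ b → d ∣ a
  ∣m+n∣n⇒∣m {d} {a} {b} d∣a+b = ∣m+n∣m⇒∣n (subst (d ∣_) (+-comm a b) d∣a+b)

gcd[m%n,n]≡gcd[m,n] : ∀ m n .{{_ : NonZero n}} → gcd (m % n) n ≡ gcd m n
gcd[m%n,n]≡gcd[m,n] m n = trans (sym (gcd[m+kn,n]≡gcd[m,n] (m % n) (m / n) n))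
                                (cong (λ x → gcd x n) (sym (m≡m%n+[m/n]*n m n)))

gcd[c*m,n]≡gcd[c*gcd[m,n],n] : ∀ c m n → gcd (c * m) n ≡ gcd (c * gcd m n) n
gcd[c*m,n]≡gcd[c*gcd[m,n],n] c m n = ∣-antisym
  (gcd-greatest
    (subst (gcd (c * m) n ∣_) (sym (c*gcd[m,n]≡gcd[cm,cn] c m n))
      (gcd-greatest (gcd[m,n]∣m (c * m) n) (∣n⇒∣m*n c (gcd[m,n]∣n (c * m) n))))
    (gcd[m,n]∣n (c * m) n))
  (gcd-greatest (∣-trans (gcd[m,n]∣m (c * gcd m n) n) (*-monoʳ-∣ c (gcd[m,n]∣m m n)))
                (gcd[m,n]∣n (c * gcd m n) n))

coprime⇒gcd[u*m,n]≡gcd[m,n] : ∀ {u n} m → Coprime u n → gcd (u * m) n ≡ gcd m n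
coprime⇒gcd[u*m,n]≡gcd[m,n] {u} {n} m u⊥n = ∣-antisym
  (gcd-greatest (coprime-divisor g⊥u (gcd[m,n]∣m (u * m) n)) (gcd[m,n]∣n (u * m) n))
  (gcd-greatest (∣n⇒∣m*n u (gcd[m,n]∣m m n)) (gcd[m,n]∣n m n))
  where
  g⊥u : Coprime (gcd (u * m) n) u
  g⊥u (d∣g , d∣u) = u⊥n (d∣u , ∣-trans d∣g (gcd[m,n]∣n (u * m) n))

coprime⇒gcd[m*a,n]≡m : ∀ {m n a} → m ∣ n → Coprime a n → gcd (m * a) n ≡ m
coprime⇒gcd[m*a,n]≡m {m} {n} {a} m∣n a⊥n = begin
  gcd (m * a) n              ≡⟨ cong (gcd (m * a)) (m∣n⇒n≡m*quotient m∣n) ⟩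
  gcd (m * a) (m * q)        ≡⟨ c*gcd[m,n]≡gcd[cm,cn] m a q ⟨
  m * gcd a q                ≡⟨ cong (m *_) (coprime⇒gcd≡1 (coprime-∣ʳ a⊥n (quotient-∣ m∣n))) ⟩
  m * 1                      ≡⟨ *-identityʳ m ⟩
  m                          ∎
  where
  open ≡-Reasoning
  q = quotient m∣n

gcd[g*a,g*b]≡g⇒coprime : ∀ {g a b} .{{_ : NonZero g}} → gcd (g * a) (g * b) ≡ g → Coprime a b
gcd[g*a,g*b]≡g⇒coprime {g} {a} {b} eq = Coprime.gcd≡1⇒coprime (*-cancelˡ-≡ (gcd a b) 1 g
  (trans (c*gcd[m,n]≡gcd[cm,cn] g a b) (trans eq (sym (*-identityʳ g)))))

[m*[n%d]]%d≡[m*n]%d : ∀ m n d .{{_ : NonZero d}} → (m * (n % d)) % d ≡ (m * n) % d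
[m*[n%d]]%d≡[m*n]%d m n d = begin
  (m * (n % d)) % d            ≡⟨ %-distribˡ-* m (n % d) d ⟩
  (m % d * (n % d % d)) % d    ≡⟨ cong (λ x → (m % d * x) % d) (m%n%n≡m%n n d) ⟩
  (m % d * (n % d)) % d        ≡⟨ %-distribˡ-* m n d ⟨
  (m * n) % d                  ∎
  where open ≡-Reasoning

%-cong-*ʳ : ∀ {a b} N g .{{_ : NonZero N}} .{{_ : NonZero (N * g)}} →
            a % N ≡ b % N → (a * g) % (N * g) ≡ (b * g) % (N * g)
%-cong-*ʳ {a} {b} N g a≡b = trans (sym (m%n*o≡m*o%[n*o] a N g))
                           (trans (cong (_* g) a≡b) (m%n*o≡m*o%[n*o] b N g))

coprime⇒∃inverse : ∀ c N .{{_ : NonZero N}} → Coprime c N → ∃[ b ] (c * b) % N ≡ 1 % N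
coprime⇒∃inverse c (suc N₀) c⊥N with coprime-Bézout c⊥N
... | Bézout.+- x y 1+yN≡xc = x ,
  trans (cong (_% suc N₀) (trans (*-comm c x) (sym 1+yN≡xc))) ([m+kn]%n≡m%n 1 y (suc N₀))
... | Bézout.-+ x y 1+xc≡yN = x * N₀ , (begin
  (c * (x * N₀)) % N                 ≡⟨ [m+kn]%n≡m%n (c * (x * N₀)) 1 N ⟨
  (c * (x * N₀) + 1 * N) % N         ≡⟨ cong (_% N) (expand c x N₀) ⟩
  (1 + (1 + x * c) * N₀) % N         ≡⟨ cong (λ z → (1 + z * N₀) % N) 1+xc≡yN ⟩
  (1 + y * N * N₀) % N               ≡⟨ cong (λ z → (1 + z) % N) (swap-last y N N₀) ⟩
  (1 + y * N₀ * N) % N               ≡⟨ [m+kn]%n≡m%n 1 (y * N₀) N ⟩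
  1 % N                              ∎)
  where
  open ≡-Reasoning
  N = suc N₀
  expand : ∀ c x N₀ → c * (x * N₀) + 1 * suc N₀ ≡ 1 + (1 + x * c) * N₀
  expand = solve-∀
  swap-last : ∀ a b c → a * b * c ≡ a * c * b
  swap-last = solve-∀

inverse⇒coprime : ∀ c b N .{{_ : NonZero N}} → (c * b) % N ≡ 1 % N → Coprime b N
inverse⇒coprime c b N cb≡1 (d∣b , d∣N) =
  ∣1⇒≡1 (∣n∣m%n⇒∣m d∣N (subst (_ ∣_) cb≡1 (%-presˡ-∣ (∣n⇒∣m*n c d∣b) d∣N)))

coprime⇒∃solution : ∀ {c y N} .{{_ : NonZero N}} → Coprime c N → Coprime y N →
                    ∃[ x ] (Coprime x N × (c * x) % N ≡ y % N)
coprime⇒∃solution {c} {y} {N} c⊥N y⊥N =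
  let b , cb≡1 = coprime⇒∃inverse c N c⊥N
  in b * y , coprime-*ˡ (inverse⇒coprime c b N cb≡1) y⊥N , (begin
    (c * (b * y)) % N               ≡⟨ cong (_% N) (*-assoc c b y) ⟨
    (c * b * y) % N                 ≡⟨ %-distribˡ-* (c * b) y N ⟩
    ((c * b) % N * (y % N)) % N     ≡⟨ cong (λ z → (z * (y % N)) % N) cb≡1 ⟩
    (1 % N * (y % N)) % N           ≡⟨ %-distribˡ-* 1 y N ⟨
    (1 * y) % N                     ≡⟨ cong (_% N) (*-identityˡ y) ⟩
    y % N                           ∎)
  where
  open ≡-Reasoning
  coprime-*ˡ : ∀ {a b c} → Coprime a c → Coprime b c → Coprime (a * b) c
  coprime-*ˡ a⊥c b⊥c = Coprime.sym (coprime-* (Coprime.sym a⊥c) (Coprime.sym b⊥c))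

module _ {s} {p : Fin s → ℕ} (primes : ∀ i → Prime (p i)) where

  ∏-primes-∤ : ℕ → ℕ
  ∏-primes-∤ x = prodFin λ j → if does (p j ∣? x) then 1 else p j

  ∤⇒∣∏-primes-∤ : ∀ {x} i → ¬ p i ∣ x → p i ∣ ∏-primes-∤ x
  ∤⇒∣∏-primes-∤ {x} i p∤x = subst (_∣ ∏-primes-∤ x) (cong (if_then 1 else p i) (dec-false (p i ∣? x) p∤x))
                                  (∣prodFin _ i)

  ∣⇒∤∏-primes-∤ : ∀ {x} i → p i ∣ x → ¬ p i ∣ ∏-primes-∤ x
  ∣⇒∤∏-primes-∤ {x} i p∣x p∣∏ with prime∣prodFin⇒∣ (primes i) p∣∏
  ... | j , p∣term with p j ∣? x
  ...   | yes _   = prime∤1 (primes i) p∣term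
  ...   | no p∤x  = p∤x (subst (_∣ x) (prime∣prime⇒≡ (primes i) (primes j) p∣term) p∣x)

  -- For c the product of the p_i not dividing x: p_i ∣ x iff p_i ∤ c N, so no p_i divides x + c N.
  coprime-lift : ∀ {x N} → Coprime x N → ∀ e → ∃[ c ] Coprime (x + c * N) (factor p e)
  coprime-lift {x} {N} x⊥N e = c , coprime-factor primes p∤x+cN e
    where
    c = ∏-primes-∤ x
    p∤x+cN : ∀ i → ¬ p i ∣ x + c * N
    p∤x+cN i p∣x+cN with p i ∣? x
    ... | no p∤x  = p∤x (∣m+n∣m⇒∣n (subst (p i ∣_) (+-comm x (c * N)) p∣x+cN)
                                   (∣m⇒∣m*n N (∤⇒∣∏-primes-∤ i p∤x)))
    ... | yes p∣x with euclidsLemma c N (primes i) (∣m+n∣m⇒∣n p∣x+cN p∣x)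
    ...   | inj₁ p∣c = ∣⇒∤∏-primes-∤ i p∣x p∣c
    ...   | inj₂ p∣N = <-irrefl (sym (x⊥N (p∣x , p∣N))) (prime⇒1< (primes i))

m≡m/n*n+m%n : ∀ m n .{{_ : NonZero n}} → m ≡ m / n * n + m % n
m≡m/n*n+m%n m n = trans (m≡m%n+[m/n]*n m n) (+-comm (m % n) _)

∣n⇒m%n∈A : ∀ {n m} .{{_ : NonZero n}} → m ∣ n → A n m (m % n)
∣n⇒m%n∈A {n} {m} m∣n = m%n<n m n , trans (gcd[m%n,n]≡gcd[m,n] m n)
                                         (∣-antisym (gcd[m,n]∣m m n) (gcd-greatest ∣-refl m∣n))

-- Multiplying A_m by k

module _ {n : ℕ} .{{_ : NonZero n}} (k : ℕ) where

  k*a%n∈kA : ∀ {m a} → A n m a → InKA n k m ((k * a) % n)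
  k*a%n∈kA {m} {a} a∈A = m%n<n (k * a) n , a , a∈A , (k * a) / n , m≡m/n*n+m%n (k * a) n

  kA⊆A[gcd] : ∀ {m y} → InKA n k m y → A n (gcd (k * m) n) y
  kA⊆A[gcd] {m} {y} (y<n , a , (_ , gcd[a,n]≡m) , q , ka≡qn+y) = y<n , (begin
    gcd y n              ≡⟨ gcd[m+kn,n]≡gcd[m,n] y q n ⟨
    gcd (y + q * n) n    ≡⟨ cong (λ z → gcd z n) (trans (+-comm y (q * n)) (sym ka≡qn+y)) ⟩
    gcd (k * a) n        ≡⟨ gcd[c*m,n]≡gcd[c*gcd[m,n],n] k a n ⟩
    gcd (k * gcd a n) n  ≡⟨ cong (λ z → gcd (k * z) n) gcd[a,n]≡m ⟩
    gcd (k * m) n        ∎)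
    where open ≡-Reasoning

  kA≡A⇒≡gcd : ∀ {m m'} → m ∣ n → (∀ y → InKA n k m y ⇔ A n m' y) → m' ≡ gcd (k * m) n
  kA≡A⇒≡gcd m∣n kA≡A = trans (sym (proj₂ (Equivalence.to (kA≡A _) y₀∈kA))) (proj₂ (kA⊆A[gcd] y₀∈kA))
    where y₀∈kA = k*a%n∈kA (∣n⇒m%n∈A m∣n)

  parent-unique : ∀ {m m₁ m₂} → Parent n k m m₁ → Parent n k m m₂ → m₁ ≡ m₂
  parent-unique ((_ , m∣n) , _ , _ , kA≡A₁) (_ , _ , _ , kA≡A₂) =
    trans (kA≡A⇒≡gcd m∣n kA≡A₁) (sym (kA≡A⇒≡gcd m∣n kA≡A₂))

module _ {s} {p : Fin s → ℕ} (primes : ∀ i → Prime (p i)) (nexp : Fin s → ℕ) (k : ℕ) where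

  private
    n = factor p nexp
    instance n≢0 = factor≢0 primes nexp

  A[gcd]⇒∃unit : ∀ {m y} → A n (gcd (k * m) n) y → ∃[ a' ] (Coprime a' n × (k * m * a') % n ≡ y)
  A[gcd]⇒∃unit {m} {y} (y<n , gcd[y,n]≡g) = a' , proj₂ lift , (begin
    (k * m * a') % n          ≡⟨ %-congˡ (cong (_* a') (m∣n⇒n≡quotient*m g∣km)) ⟩
    (c * g * a') % n          ≡⟨ %-congˡ (swap c g a') ⟩
    (c * a' * g) % n          ≡⟨ %-congʳ n≡Ng ⟩
    (c * a' * g) % (N * g)    ≡⟨ %-cong-*ʳ N g ca'≡y' ⟩
    (y' * g) % (N * g)        ≡⟨ %-congʳ n≡Ng ⟨
    (y' * g) % n              ≡⟨ %-congˡ (m∣n⇒n≡quotient*m g∣y) ⟨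
    y % n                     ≡⟨ m<n⇒m%n≡m y<n ⟩
    y                         ∎)
    where
    open ≡-Reasoning
    g = gcd (k * m) n
    g∣km = gcd[m,n]∣m (k * m) n
    g∣n = gcd[m,n]∣n (k * m) n
    g∣y = subst (_∣ y) gcd[y,n]≡g (gcd[m,n]∣m y n)
    c = quotient g∣km
    N = quotient g∣n
    y' = quotient g∣y
    instance
      g≢0 : NonZero g
      g≢0 = ≢-nonZero (gcd[m,n]≢0 (k * m) n (inj₂ (≢-nonZero⁻¹ n)))
      N≢0 : NonZero N
      N≢0 = quotient≢0 g∣n
      Ng≢0 : NonZero (N * g)
      Ng≢0 = m*n≢0 N g
    n≡Ng = m∣n⇒n≡quotient*m g∣n
    c⊥N : Coprime c N
    c⊥N = gcd[g*a,g*b]≡g⇒coprime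
      (sym (cong₂ gcd (m∣n⇒n≡m*quotient g∣km) (m∣n⇒n≡m*quotient g∣n)))
    y'⊥N : Coprime y' N
    y'⊥N = gcd[g*a,g*b]≡g⇒coprime
      (trans (sym (cong₂ gcd (m∣n⇒n≡m*quotient g∣y) (m∣n⇒n≡m*quotient g∣n))) gcd[y,n]≡g)
    solution = coprime⇒∃solution c⊥N y'⊥N
    x = proj₁ solution
    lift = coprime-lift primes (proj₁ (proj₂ solution)) nexp
    t = proj₁ lift
    a' = x + t * N
    ca'≡y' : (c * a') % N ≡ y' % N
    ca'≡y' = begin
      (c * (x + t * N)) % N    ≡⟨ cong (_% N) (distrib c x t N) ⟩
      (c * x + c * t * N) % N  ≡⟨ [m+kn]%n≡m%n (c * x) (c * t) N ⟩
      (c * x) % N              ≡⟨ proj₂ (proj₂ solution) ⟩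
      y' % N                   ∎
      where
      distrib : ∀ c x t N → c * (x + t * N) ≡ c * x + c * t * N
      distrib = solve-∀
    swap : ∀ c g a → c * g * a ≡ c * a * g
    swap = solve-∀

  A[gcd]⊆kA : ∀ {m y} → m ∣ n → A n (gcd (k * m) n) y → InKA n k m y
  A[gcd]⊆kA {m} {y} m∣n y∈A = proj₁ y∈A , a , a∈A , (k * a) / n ,
    subst (λ z → k * a ≡ (k * a) / n * n + z) ka%n≡y (m≡m/n*n+m%n (k * a) n)
    where
    unit = A[gcd]⇒∃unit y∈A
    a' = proj₁ unit
    a = (m * a') % n
    a∈A : A n m a
    a∈A = m%n<n _ n , trans (gcd[m%n,n]≡gcd[m,n] (m * a') n) (coprime⇒gcd[m*a,n]≡m m∣n (proj₁ (proj₂ unit)))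
    ka%n≡y : (k * a) % n ≡ y
    ka%n≡y = begin
      (k * ((m * a') % n)) % n  ≡⟨ [m*[n%d]]%d≡[m*n]%d k (m * a') n ⟩
      (k * (m * a')) % n        ≡⟨ %-congˡ (*-assoc k m a') ⟨
      (k * m * a') % n          ≡⟨ proj₂ (proj₂ unit) ⟩
      y                         ∎
      where open ≡-Reasoning

  kA≡A[gcd] : ∀ {m} → m ∣ n → ∀ y → InKA n k m y ⇔ A n (gcd (k * m) n) y
  kA≡A[gcd] m∣n y = mk⇔ (kA⊆A[gcd] k) (A[gcd]⊆kA m∣n)

select-< : ∀ {s r} {f g : Fin s → ℕ} i → toℕ i < r → select r f g i ≡ f i
select-< {r = r} i i<r with toℕ i <ᵇ r | <⇒<ᵇ i<r
... | true | _ = refl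

select-≥ : ∀ {s r} {f g : Fin s → ℕ} i → r ≤ toℕ i → select r f g i ≡ g i
select-≥ {r = r} i r≤i with toℕ i <ᵇ r in eq
... | false = refl
... | true  = ⊥-elim (<⇒≱ (<ᵇ⇒< (toℕ i) r (subst T (sym eq) tt)) r≤i)

sumFin : ∀ {s} → (Fin s → ℕ) → ℕ
sumFin {zero}  f = 0
sumFin {suc s} f = f fzero + sumFin (f ∘ fsuc)

≤sumFin : ∀ {s} (f : Fin s → ℕ) i → f i ≤ sumFin f
≤sumFin f fzero    = m≤m+n _ _
≤sumFin f (fsuc i) = ≤-trans (≤sumFin (f ∘ fsuc) i) (m≤n+m _ (f fzero))

m∸[n⊓m]≡m∸n : ∀ m n → m ∸ (n ⊓ m) ≡ m ∸ n
m∸[n⊓m]≡m∸n m n with ≤-total n m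
... | inj₁ n≤m = cong (m ∸_) (m≤n⇒m⊓n≡m n≤m)
... | inj₂ m≤n = trans (cong (m ∸_) (m≥n⇒m⊓n≡n m≤n)) (trans (n∸n≡0 m) (sym (m≤n⇒m∸n≡0 m≤n)))

m∸n≤o⇔m≤n+o : ∀ m n o → (m ∸ n ≤ o) ⇔ (m ≤ n + o)
m∸n≤o⇔m≤n+o m n o = mk⇔ (λ m∸n≤o → ≤-trans (m≤n+m∸n m n) (+-monoʳ-≤ n m∸n≤o)) (m≤n+o⇒m∸n≤o m n)

[k+[e∸k]]⊓n≡e : ∀ {k e n} → e ≤ n → k ⊓ n ≤ e → (k + (e ∸ k)) ⊓ n ≡ e
[k+[e∸k]]⊓n≡e {k} {e} {n} e≤n k⊓n≤e with ≤-total k e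
... | inj₁ k≤e = trans (cong (_⊓ n) (m+[n∸m]≡n k≤e)) (m≤n⇒m⊓n≡m e≤n)
... | inj₂ e≤k = trans (cong (λ x → (k + x) ⊓ n) (m≤n⇒m∸n≡0 e≤k))
                       (trans (cong (_⊓ n) (+-identityʳ k)) (≤-antisym k⊓n≤e (⊓-glb e≤k e≤n)))

m∸n<o : ∀ {m n o} → m ≤ o → 1 ≤ n → 1 ≤ o → m ∸ n < o
m∸n<o {zero}  {n} {o} _   _ 1≤o = subst (_< o) (sym (0∸n≡0 n)) 1≤o
m∸n<o {suc m} {suc n} m<o _ _   = ≤-<-trans (m∸n≤m m n) m<o

-- The tree

module Tree (s r : ℕ) (p nexp kexp : Fin s → ℕ) (u : ℕ)
  (primes : ∀ i → Prime (p i)) (p-inj : Injective _≡_ _≡_ p)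
  (nexp≥1 : ∀ i → 1 ≤ nexp i) (r≥1 : 1 ≤ r) (r≤s : r ≤ s)
  (kexp≥1 : ∀ i → toℕ i < r → 1 ≤ kexp i) (u⊥p : ∀ i → Coprime u (p i)) where

  F : (Fin s → ℕ) → ℕ
  F = factor p

  n : ℕ
  n = F nexp

  κ : Fin s → ℕ
  κ = select r kexp (const 0)

  k : ℕ
  k = u * F κ

  instance
    n≢0 : NonZero n
    n≢0 = factor≢0 primes nexp

  Bounded : (Fin s → ℕ) → Set
  Bounded e = ∀ i → e i ≤ nexp i

  Full : (Fin s → ℕ) → Set
  Full e = ∀ i → toℕ i < r → e i ≡ nexp i

  SameTail : (Fin s → ℕ) → (Fin s → ℕ) → Set
  SameTail e e' = ∀ i → r ≤ toℕ i → e i ≡ e' i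

  up : (Fin s → ℕ) → Fin s → ℕ
  up e i = (κ i + e i) ⊓ nexp i

  down : (Fin s → ℕ) → Fin s → ℕ
  down e i = e i ∸ κ i

  saturate : (Fin s → ℕ) → Fin s → ℕ
  saturate = select r nexp

  κ-head : ∀ {i} → toℕ i < r → κ i ≡ kexp i
  κ-head {i} = select-< {f = kexp} {g = const 0} i

  κ-tail : ∀ {i} → r ≤ toℕ i → κ i ≡ 0
  κ-tail {i} = select-≥ {f = kexp} {g = const 0} i

  full? : ∀ e → Dec (Full e)
  full? e = all? (λ i → (toℕ i <? r) →-dec (e i ≟ nexp i))

  vertex⇒factor : ∀ {m} → Vertex n m → ∃[ e ] (Bounded e × m ≡ F e)
  vertex⇒factor (_ , m∣n) = ∣factor⇒factor primes nexp m∣n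

  vertex⇒bounded : ∀ {e} → Vertex n (F e) → Bounded e
  vertex⇒bounded (_ , e∣n) = factor-∣⇒≤ primes p-inj _ nexp e∣n

  bounded⇒vertex : ∀ {e} → Bounded e → Vertex n (F e)
  bounded⇒vertex {e} e≤ = >-nonZero⁻¹ (F e) {{factor≢0 primes e}} , factor-mono-∣ p e≤

  up-bounded : ∀ e → Bounded (up e)
  up-bounded e i = m⊓n≤n _ _

  ≤up : ∀ {e} → Bounded e → ∀ i → e i ≤ up e i
  ≤up e≤ i = ⊓-glb (m≤n+m _ (κ i)) (e≤ i)

  up-head : ∀ e {i} → toℕ i < r → up e i ≡ (kexp i + e i) ⊓ nexp i
  up-head e {i} i<r = cong (λ x → (x + e i) ⊓ nexp i) (κ-head i<r)

  up-tail : ∀ {e} → Bounded e → SameTail (up e) e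
  up-tail {e} e≤ i r≤i = trans (cong (λ x → (x + e i) ⊓ nexp i) (κ-tail r≤i)) (m≤n⇒m⊓n≡m (e≤ i))

  full⇒up≗id : ∀ {e} → Bounded e → Full e → ∀ i → up e i ≡ e i
  full⇒up≗id {e} e≤ full i with toℕ i <? r
  ... | no  i≮r = up-tail e≤ i (≮⇒≥ i≮r)
  ... | yes i<r = trans (m≥n⇒m⊓n≡n (subst (_≤ κ i + e i) (full i i<r) (m≤n+m (e i) (κ i))))
                        (sym (full i i<r))

  up≗id⇒full : ∀ {e} → (∀ i → up e i ≡ e i) → Full e
  up≗id⇒full {e} fixed i i<r with ≤-total (kexp i + e i) (nexp i)
  ... | inj₁ k+e≤n = ⊥-elim (<-irrefl (sym k+e≡e) (m<n+m (e i) (kexp≥1 i i<r)))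
    where
    k+e≡e : kexp i + e i ≡ e i
    k+e≡e = trans (sym (m≤n⇒m⊓n≡m k+e≤n)) (trans (sym (up-head e i<r)) (fixed i))
  ... | inj₂ n≤k+e = trans (sym (fixed i)) (trans (up-head e i<r) (m≥n⇒m⊓n≡n n≤k+e))

  gcd[k*F[e],n]≡F[up[e]] : ∀ e → gcd (k * F e) n ≡ F (up e)
  gcd[k*F[e],n]≡F[up[e]] e = begin
    gcd (u * F κ * F e) n           ≡⟨ cong (λ x → gcd x n) (*-assoc u (F κ) (F e)) ⟩
    gcd (u * (F κ * F e)) n         ≡⟨ coprime⇒gcd[u*m,n]≡gcd[m,n] (F κ * F e) u⊥n ⟩
    gcd (F κ * F e) n               ≡⟨ cong (λ x → gcd x n) (factor-+ p κ e) ⟨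
    gcd (F (λ i → κ i + e i)) n     ≡⟨ gcd-factor primes p-inj (λ i → κ i + e i) nexp ⟩
    F (up e)                        ∎
    where
    open ≡-Reasoning
    u⊥n : Coprime u n
    u⊥n = coprime-prodFin (λ i → coprime-^ (u⊥p i) (nexp i))

  F<F[up] : ∀ {e} → Bounded e → ¬ Full e → F e < F (up e)
  F<F[up] {e} e≤ ¬full = ≤∧≢⇒< (∣⇒≤ {{factor≢0 primes (up e)}} (factor-mono-∣ p (≤up e≤)))
    λ Fe≡ → ¬full (up≗id⇒full (λ i → sym (factor-injective primes p-inj e (up e) Fe≡ i)))

  parent⇒up : ∀ {e m'} → Bounded e → Parent n k (F e) m' → m' ≡ F (up e) × ¬ Full e
  parent⇒up {e} e≤ ((_ , e∣n) , _ , Fe<m' , kA≡A) = m'≡ , λ full →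
    <-irrefl (sym (trans m'≡ (factor-cong p (full⇒up≗id e≤ full)))) Fe<m'
    where
    m'≡ = trans (kA≡A⇒≡gcd k e∣n kA≡A) (gcd[k*F[e],n]≡F[up[e]] e)

  ¬full⇒parent : ∀ {e} → Bounded e → ¬ Full e → Parent n k (F e) (F (up e))
  ¬full⇒parent {e} e≤ ¬full = bounded⇒vertex e≤ , bounded⇒vertex (up-bounded e) , F<F[up] e≤ ¬full ,
    λ y → subst (λ g → InKA n k (F e) y ⇔ A n g y) (gcd[k*F[e],n]≡F[up[e]] e)
                (kA≡A[gcd] primes nexp k (proj₂ (bounded⇒vertex e≤)) y)

  root⇒full : ∀ {e} → Bounded e → IsRoot n k (F e) → Full e
  root⇒full {e} e≤ (_ , no-parent) with full? e
  ... | yes full = full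
  ... | no ¬full = ⊥-elim (no-parent (_ , ¬full⇒parent e≤ ¬full))

  full⇒root : ∀ {e} → Bounded e → Full e → IsRoot n k (F e)
  full⇒root e≤ full = bounded⇒vertex e≤ , λ (_ , par) → proj₂ (parent⇒up e≤ par) full

  parent⇒sameTail : ∀ e e' → Parent n k (F e) (F e') → SameTail e e'
  parent⇒sameTail e e' par i r≤i =
    trans (sym (up-tail e≤ i r≤i)) (factor-injective primes p-inj (up e) e' (sym (proj₁ (parent⇒up e≤ par))) i)
    where e≤ = vertex⇒bounded (proj₁ par)

  connected⇒sameTail : ∀ {m m'} → Connected n k m m' → ∀ e e' → m ≡ F e → m' ≡ F e' → SameTail e e'
  connected⇒sameTail ε e e' m≡ m'≡ i _ = factor-injective primes p-inj e e' (trans (sym m≡) m'≡) i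
  connected⇒sameTail (fwd par ◅ c) e e' refl m'≡ i r≤i with vertex⇒factor (proj₁ (proj₂ par))
  ... | e₁ , _ , refl = trans (parent⇒sameTail e e₁ par i r≤i) (connected⇒sameTail c e₁ e' refl m'≡ i r≤i)
  connected⇒sameTail (bwd par ◅ c) e e' refl m'≡ i r≤i with vertex⇒factor (proj₁ par)
  ... | e₁ , _ , refl = trans (sym (parent⇒sameTail e₁ e par i r≤i)) (connected⇒sameTail c e₁ e' refl m'≡ i r≤i)

  full∧sameTail⇒≗ : ∀ {e e'} → Full e → Full e' → SameTail e e' → ∀ i → e i ≡ e' i
  full∧sameTail⇒≗ full full' same i with toℕ i <? r
  ... | yes i<r = trans (full i i<r) (sym (full' i i<r))
  ... | no  i≮r = same i (≮⇒≥ i≮r)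

  saturate-full : ∀ e → Full (saturate e)
  saturate-full e i = select-< {f = nexp} {g = e} i

  saturate-sameTail : ∀ e → SameTail (saturate e) e
  saturate-sameTail e i = select-≥ {f = nexp} {g = e} i

  saturate-bounded : ∀ {e} → (∀ i → r ≤ toℕ i → e i ≤ nexp i) → Bounded (saturate e)
  saturate-bounded {e} tail≤ i with toℕ i <? r
  ... | yes i<r = ≤-reflexive (saturate-full e i i<r)
  ... | no  i≮r = subst (_≤ nexp i) (sym (saturate-sameTail e i (≮⇒≥ i≮r))) (tail≤ i (≮⇒≥ i≮r))

  full⇒F≡F[saturate] : ∀ {e} → Full e → F e ≡ F (saturate e)
  full⇒F≡F[saturate] {e} full = factor-cong p
    (full∧sameTail⇒≗ full (saturate-full e) (λ i r≤i → sym (saturate-sameTail e i r≤i)))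

  sameTail⇒F[saturate]≡ : ∀ {e e'} → SameTail e e' → F (saturate e) ≡ F (saturate e')
  sameTail⇒F[saturate]≡ {e} {e'} same = factor-cong p (full∧sameTail⇒≗ (saturate-full e) (saturate-full e')
    λ i r≤i → trans (saturate-sameTail e i r≤i) (trans (same i r≤i) (sym (saturate-sameTail e' i r≤i))))

  JGood-zero⇒full : ∀ {e} → Bounded e → JGood nexp kexp e r 0 → Full e
  JGood-zero⇒full e≤ good i i<r = ≤-antisym (e≤ i) (m∸n≡0⇒m≤n (n≤0⇒n≡0 (good i i<r)))

  full⇒JGood-zero : ∀ {e} → Full e → JGood nexp kexp e r 0
  full⇒JGood-zero {e} full i i<r = ≤-reflexive (trans (cong (nexp i ∸_) (full i i<r)) (n∸n≡0 (nexp i)))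

  nexp∸up : ∀ e {i} → toℕ i < r → nexp i ∸ up e i ≡ (nexp i ∸ e i) ∸ kexp i
  nexp∸up e {i} i<r = begin
    nexp i ∸ up e i                    ≡⟨ cong (nexp i ∸_) (up-head e i<r) ⟩
    nexp i ∸ ((kexp i + e i) ⊓ nexp i) ≡⟨ m∸[n⊓m]≡m∸n (nexp i) (kexp i + e i) ⟩
    nexp i ∸ (kexp i + e i)            ≡⟨ cong (nexp i ∸_) (+-comm (kexp i) (e i)) ⟩
    nexp i ∸ (e i + kexp i)            ≡⟨ ∸-+-assoc (nexp i) (e i) (kexp i) ⟨
    (nexp i ∸ e i) ∸ kexp i            ∎
    where open ≡-Reasoning

  JGood-up⇔JGood-suc : ∀ e j → JGood nexp kexp (up e) r j ⇔ JGood nexp kexp e r (suc j)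
  JGood-up⇔JGood-suc e j = mk⇔
    (λ good i i<r → Equivalence.to (at i) (subst (_≤ j * kexp i) (nexp∸up e i<r) (good i i<r)))
    (λ good i i<r → subst (_≤ j * kexp i) (sym (nexp∸up e i<r)) (Equivalence.from (at i) (good i i<r)))
    where
    at : ∀ i → ((nexp i ∸ e i) ∸ kexp i ≤ j * kexp i) ⇔ (nexp i ∸ e i ≤ kexp i + j * kexp i)
    at i = m∸n≤o⇔m≤n+o (nexp i ∸ e i) (kexp i) (j * kexp i)

  JGood-sumFin : ∀ e → JGood nexp kexp e r (sumFin nexp)
  JGood-sumFin e i i<r = ≤-trans (m∸n≤m (nexp i) (e i))
    (≤-trans (≤sumFin nexp i) (m≤m*n (sumFin nexp) (kexp i) {{>-nonZero (kexp≥1 i i<r)}}))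

  JGood⇒connected-saturate : ∀ j {e} → Bounded e → JGood nexp kexp e r j → Connected n k (F e) (F (saturate e))
  JGood⇒connected-saturate zero e≤ good =
    subst (Connected n k _) (full⇒F≡F[saturate] (JGood-zero⇒full e≤ good)) ε
  JGood⇒connected-saturate (suc j) {e} e≤ good with full? e
  ... | yes full = subst (Connected n k _) (full⇒F≡F[saturate] full) ε
  ... | no ¬full = fwd (¬full⇒parent e≤ ¬full) ◅
    subst (Connected n k _) (sameTail⇒F[saturate]≡ (up-tail e≤))
          (JGood⇒connected-saturate j (up-bounded e) (Equivalence.from (JGood-up⇔JGood-suc e j) good))

  connected-saturate : ∀ {e} → Bounded e → Connected n k (F e) (F (saturate e))
  connected-saturate {e} e≤ = JGood⇒connected-saturate (sumFin nexp) e≤ (JGood-sumFin e)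

  InM-index? : ∀ (e : Fin s → ℕ) → Dec (∃[ i₀ ] (toℕ i₀ < r × e i₀ < kexp i₀ ⊓ nexp i₀))
  InM-index? e = any? (λ i → (toℕ i <? r) ×-dec (e i <? kexp i ⊓ nexp i))

  ¬InM⇒κ⊓nexp≤ : ∀ {e : Fin s → ℕ} → ¬ (∃[ i₀ ] (toℕ i₀ < r × e i₀ < kexp i₀ ⊓ nexp i₀)) → ∀ i → κ i ⊓ nexp i ≤ e i
  ¬InM⇒κ⊓nexp≤ {e} ¬InM i with toℕ i <? r
  ... | yes i<r = subst (λ x → x ⊓ nexp i ≤ e i) (sym (κ-head i<r)) (≮⇒≥ λ lt → ¬InM (i , i<r , lt))
  ... | no  i≮r = subst (λ x → x ⊓ nexp i ≤ e i) (sym (κ-tail (≮⇒≥ i≮r))) z≤n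

  down-bounded : ∀ {e} → Bounded e → Bounded (down e)
  down-bounded e≤ i = ≤-trans (m∸n≤m _ (κ i)) (e≤ i)

  down-¬full : ∀ {e} → Bounded e → ¬ Full (down e)
  down-¬full {e} e≤ full = <-irrefl (full i₀ i₀<r) (m∸n<o (e≤ i₀) κ≥1 (nexp≥1 i₀))
    where
    i₀ = fromℕ< (≤-trans r≥1 r≤s)
    i₀<r = subst (_< r) (sym (toℕ-fromℕ< (≤-trans r≥1 r≤s))) r≥1
    κ≥1 = subst (1 ≤_) (sym (κ-head i₀<r)) (kexp≥1 i₀ i₀<r)

  leaf⇒InM : ∀ {m} → Vertex n m → IsLeaf n k m → InM p nexp kexp r m
  leaf⇒InM vm (_ , no-child) with vertex⇒factor vm
  ... | e , e≤ , refl with InM-index? e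
  ...   | yes (i₀ , i₀<r , lt) = e , refl , e≤ , i₀ , i₀<r , lt
  ...   | no ¬InM = ⊥-elim (no-child (F (down e) ,
    subst (Parent n k _) (factor-cong p λ i → [k+[e∸k]]⊓n≡e (e≤ i) (¬InM⇒κ⊓nexp≤ ¬InM i))
          (¬full⇒parent (down-bounded e≤) (down-¬full e≤))))

  InM⇒leaf : ∀ {m} → Vertex n m → InM p nexp kexp r m → IsLeaf n k m
  InM⇒leaf vm (e , refl , e≤ , i₀ , i₀<r , lt) = vm , no-child
    where
    no-child : ¬ (∃[ c ] Parent n k c (F e))
    no-child (c , par) with vertex⇒factor (proj₁ par)
    ... | f , f≤ , refl = <-irrefl e≡up (<-≤-trans lt (subst (kexp i₀ ⊓ nexp i₀ ≤_) (sym (up-head f i₀<r))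
                                                  (⊓-monoˡ-≤ (nexp i₀) (m≤m+n (kexp i₀) (f i₀)))))
      where
      e≡up : e i₀ ≡ up f i₀
      e≡up = factor-injective primes p-inj e (up f) (proj₁ (parent⇒up f≤ par)) i₀

  IsJm-suc⇒IsJm-up : ∀ {e j} → Bounded e → IsJm nexp kexp e r (suc j) → ¬ Full e × IsJm nexp kexp (up e) r j
  IsJm-suc⇒IsJm-up {e} {j} e≤ (good , least) =
    (λ full → 1+n≰n (≤-trans (least 0 (full⇒JGood-zero full)) z≤n)) ,
    Equivalence.from (JGood-up⇔JGood-suc e j) good ,
    λ j' good' → s≤s⁻¹ (least (suc j') (Equivalence.to (JGood-up⇔JGood-suc e j') good'))

  IsJm-up⇒IsJm-suc : ∀ {e j} → Bounded e → ¬ Full e → IsJm nexp kexp (up e) r j → IsJm nexp kexp e r (suc j)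
  IsJm-up⇒IsJm-suc {e} {j} e≤ ¬full (good , least) = Equivalence.to (JGood-up⇔JGood-suc e j) good , least'
    where
    least' : ∀ j' → JGood nexp kexp e r j' → suc j ≤ j'
    least' zero     good₀ = ⊥-elim (¬full (JGood-zero⇒full e≤ good₀))
    least' (suc j') good' = s≤s (least j' (Equivalence.from (JGood-up⇔JGood-suc e j') good'))

  pathToRoot⇒IsJm : ∀ j {e} → Bounded e → PathToRoot n k (F e) j → IsJm nexp kexp e r j
  pathToRoot⇒IsJm zero    e≤ root = full⇒JGood-zero (root⇒full e≤ root) , λ _ _ → z≤n
  pathToRoot⇒IsJm (suc j) {e} e≤ (_ , par , path) with parent⇒up e≤ par
  ... | refl , ¬full = IsJm-up⇒IsJm-suc e≤ ¬full (pathToRoot⇒IsJm j (up-bounded e) path)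

  IsJm⇒pathToRoot : ∀ j {e} → Bounded e → IsJm nexp kexp e r j → PathToRoot n k (F e) j
  IsJm⇒pathToRoot zero    e≤ (good , _) = full⇒root e≤ (JGood-zero⇒full e≤ good)
  IsJm⇒pathToRoot (suc j) {e} e≤ jm =
    let ¬full , jm' = IsJm-suc⇒IsJm-up e≤ jm
    in F (up e) , ¬full⇒parent e≤ ¬full , IsJm⇒pathToRoot j (up-bounded e) jm'

  saturate-root : ∀ {e} → (∀ i → r ≤ toℕ i → e i ≤ nexp i) → IsRoot n k (F (saturate e))
  saturate-root {e} tail≤ = full⇒root (saturate-bounded tail≤) (saturate-full e)

  root-exists : ∀ m → Vertex n m → ∃[ ρ ] (IsRoot n k ρ × Connected n k m ρ)
  root-exists m vm with vertex⇒factor vm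
  ... | e , e≤ , refl = F (saturate e) , saturate-root (λ i _ → e≤ i) , connected-saturate e≤

  root-unique : ∀ ρ₁ ρ₂ → IsRoot n k ρ₁ → IsRoot n k ρ₂ → Connected n k ρ₁ ρ₂ → ρ₁ ≡ ρ₂
  root-unique ρ₁ ρ₂ root₁ root₂ c with vertex⇒factor (proj₁ root₁) | vertex⇒factor (proj₁ root₂)
  ... | e₁ , e₁≤ , refl | e₂ , e₂≤ , refl = factor-cong p
    (full∧sameTail⇒≗ (root⇒full e₁≤ root₁) (root⇒full e₂≤ root₂) (connected⇒sameTail c e₁ e₂ refl refl))

  components : ∀ m m' e e' → Vertex n m → Vertex n m' → m ≡ F e → m' ≡ F e' →
               Connected n k m m' ⇔ SameTail e e'
  components _ _ e e' vm vm' refl refl = mk⇔ (λ c → connected⇒sameTail c e e' refl refl) λ same →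
    connected-saturate (vertex⇒bounded vm) ◅◅
    subst (λ ρ → Connected n k ρ (F e')) (sym (sameTail⇒F[saturate]≡ same))
          (symmetric (Parent n k) (connected-saturate (vertex⇒bounded vm')))

  leaves : ∀ m → Vertex n m → IsLeaf n k m ⇔ InM p nexp kexp r m
  leaves m vm = mk⇔ (leaf⇒InM vm) (InM⇒leaf vm)

  roots : ∀ d → (∀ i → r ≤ toℕ i → d i ≤ nexp i) →
          IsRoot n k (F (saturate d)) ×
          (∀ m e → Vertex n m → m ≡ F e → SameTail e d → Connected n k m (F (saturate d)))
  roots d d≤ = saturate-root d≤ , λ { _ e vm refl same →
    subst (Connected n k (F e)) (sameTail⇒F[saturate]≡ same) (connected-saturate (vertex⇒bounded {e} vm)) }

  levels : ∀ m e → Vertex n m → m ≡ F e → ∀ j → HasLevel n k m (suc j) ⇔ IsJm nexp kexp e r j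
  levels _ e vm refl j = mk⇔
    (λ { (_ , refl , path) → pathToRoot⇒IsJm j {e} (vertex⇒bounded vm) path })
    (λ jm → j , refl , IsJm⇒pathToRoot j {e} (vertex⇒bounded vm) jm)

proposition2 :
  (s r : ℕ) (p nexp kexp : Fin s → ℕ) (u : ℕ) →
  (∀ i → Prime (p i)) → Injective _≡_ _≡_ p →
  (∀ i → 1 ≤ nexp i) →
  1 ≤ r → r ≤ s →
  (∀ i → toℕ i < r → 1 ≤ kexp i) →
  (∀ i → Coprime u (p i)) →
  let n = factor p nexp
      k = u * factor p (select r kexp (const 0))
  in
  -- G is a disjoint union of rooted trees: parents are unique, and every
  -- connected component contains exactly one root (vertex without parent)
  (∀ m m₁ m₂ → Parent n k m m₁ → Parent n k m m₂ → m₁ ≡ m₂) ×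
  (∀ m → Vertex n m → ∃[ ρ ] (IsRoot n k ρ × Connected n k m ρ)) ×
  (∀ ρ₁ ρ₂ → IsRoot n k ρ₁ → IsRoot n k ρ₂ → Connected n k ρ₁ ρ₂ → ρ₁ ≡ ρ₂) ×
  -- (i) components ↔ exponents (d_i) for the indices i > r
  (∀ m m' e e' → Vertex n m → Vertex n m' → m ≡ factor p e → m' ≡ factor p e' →
    (Connected n k m m' ⇔ (∀ i → r ≤ toℕ i → e i ≡ e' i))) ×
  -- (ii) leaves are exactly the elements of 𝓜
  (∀ m → Vertex n m → (IsLeaf n k m ⇔ InM p nexp kexp r m)) ×
  -- (iii) the root of the tree corresponding to (d_i)
  (∀ d → (∀ i → r ≤ toℕ i → d i ≤ nexp i) →
    IsRoot n k (factor p (select r nexp d)) ×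
    (∀ m e → Vertex n m → m ≡ factor p e → (∀ i → r ≤ toℕ i → e i ≡ d i) →
      Connected n k m (factor p (select r nexp d)))) ×
  -- (iv) m = ∏ p_i^{m_i} has level j_m + 1
  (∀ m e → Vertex n m → m ≡ factor p e →
    ∀ j → (HasLevel n k m (suc j) ⇔ IsJm nexp kexp e r j))
proposition2 s r p nexp kexp u primes p-inj nexp≥1 r≥1 r≤s kexp≥1 u⊥p =
  (λ _ _ _ → parent-unique k) , root-exists , root-unique , components , leaves , roots , levels
  where open Tree s r p nexp kexp u primes p-inj nexp≥1 r≥1 r≤s kexp≥1 u⊥p
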